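{- If $G'\subseteq G$ are sets of nodes, then $E_{G'}\subseteq E_{G}$ and $A_{G'}\subseteq A_{G}$.
   Context: Setting: formulas of the (alternation-free) modal $\mu$-calculus $\psi,\phi ::= \bot \mid \top \mid p \mid \neg p \mid X \mid \psi\wedge\phi \mid \psi\vee\phi \mid \langle a \rangle\psi \mid [a]\psi \mid \mu X.\,\psi \mid \nu X.\,\psi$, assumed guarded, clean and irredundant. Tableau rules (premise / conclusions): $(\bot)$: $\Gamma,\bot$ / no conclusion; (clash): $\Gamma,p,\neg p$ / no conclusion; $(\wedge)$: $\Gamma,\psi\wedge\phi$ / $\Gamma,\psi,\phi$; $(\vee)$: $\Gamma,\psi\vee\phi$ / $\Gamma,\psi$ and $\Gamma,\phi$; $(\langle a\rangle)$: $\Gamma,[a]\psi_1,\ldots,[a]\psi_n,\langle a\rangle\phi$ / $\psi_1,\ldots,\psi_n,\phi$; $(\eta)$: $\Gamma,\eta X.\,\psi$ / $\Gamma,\psi[X\mapsto\eta X.\,\psi]$. $\mathcal{R}_m$ is the set of modal rules, $\mathcal{R}_p$ the rest. Nodes are subsets of the Fischer–Ladner closure of the input formula; state nodes contain only $\top$, non-clashing propositional literals and modal literals. $\mathrm{concl}(\Delta)$ is the set of conclusion sets of rules from $\mathcal{R}_m$ (if $\Delta$ is a state node) or $\mathcal{R}_p$ (otherwise) with premise $\Delta$. A focused node is $(\Gamma,d)$ with $d\subseteq\Gamma$ a set of deferrals (formulas belonging to eventualities); $\mathbf{C}_G$ is the set of focused nodes whose label $\Gamma$ lies in $G$. $d_{\Delta\leadsto\Gamma}$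 is the set of deferrals obtained by tracking $d$ from premise $\Delta$ to conclusion $\Gamma$, and $\emptyset_{\Delta\leadsto\Gamma}=d(\Gamma)$ (all deferrals in $\Gamma$). For base set $C$ and $Y\subseteq C$: $f(Y)=\{(\Delta,d)\in C\mid \forall \Sigma\in\mathrm{concl}(\Delta).\,\exists\Gamma\in\Sigma.\,(\Gamma,d_{\Delta\leadsto\Gamma})\in Y\}$, $g(Y)=\{(\Delta,d)\in C\mid \exists \Sigma\in\mathrm{concl}(\Delta).\,\forall\Gamma\in\Sigma.\,(\Gamma,d_{\Delta\leadsto\Gamma})\in Y\}$; with $F$ the focused nodes in $C$ with empty focus and $\overline{F}$ those with nonempty focus, $\hat{f}_X(Y)=(f(Y)\cap\overline{F})\cup(f(X)\cap F)$ and $\hat{g}_X(Y)=(g(Y)\cup F)\cap(g(X)\cup\overline{F})$. For a set $G$ of nodes, $E_G=\nu X.\mu Y.\,\hat{f}_X(Y)$ and $A_G=\mu X.\nu Y.\,\hat{g}_X(Y)$, computed with base set $\mathbf{C}_G$. -}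

module Defs where

open import Data.Nat using (ℕ; zero; suc; _^_)
open import Data.Bool using (Bool; true; false; not; _∧_; _∨_; if_then_else_)
open import Data.List using (List)
open import Data.Bool.ListAction using (any; all)
open import Data.Vec using (Vec; []; _∷_)
open import Data.Fin.Subset using (Subset)
open import Data.Product using (_×_; _,_)
open import Relation.Binary.PropositionalEquality using (_≡_)

-- Formulas of the Fischer–Ladner closure of the input formula are
-- represented by Fin n; a node is a subset of the closure (Subset n).
Node : ℕ → Set
Node n = Subset n

isEmpty : ∀ {n} → Subset n → Bool
isEmpty []       = true
isEmpty (x ∷ v)  = not x ∧ isEmpty v

subsetB : ∀ {n} → Subset n → Subset n → Bool
subsetB []       []       = true
subsetB (x ∷ u)  (y ∷ v)  = (not x ∨ y) ∧ subsetB u v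

-- The data of the tableau calculus that the fixpoint definitions use:
--   concl Δ      : the set of conclusion sets of the applicable rules
--                  (modal rules if Δ is a state node, else propositional);
--   defer Γ      : d(Γ), the set of all deferrals in Γ;
--   track d Δ Γ  : d_{Δ⇝Γ}, tracking the deferrals d from premise Δ to
--                  conclusion Γ.
record Tableau (n : ℕ) : Set where
  field
    concl : Node n → List (List (Node n))
    defer : Node n → Subset n
    track : Subset n → Node n → Node n → Subset n

NodeSet : ℕ → Set
NodeSet n = Node n → Bool

FNode : ℕ → Set
FNode n = Node n × Subset n

FSet : ℕ → Set
FSet n = FNode n → Bool

_⊆N_ : ∀ {n} → NodeSet n → NodeSet n → Set
S ⊆N T = ∀ x → S x ≡ true → T x ≡ true

_⊆F_ : ∀ {n} → FSet n → FSet n → Set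
S ⊆F T = ∀ x → S x ≡ true → T x ≡ true

module _ {n : ℕ} (T : Tableau n) where
  open Tableau T

  -- d_{Δ⇝Γ}, with the convention ∅_{Δ⇝Γ} = d(Γ)
  tracked : Node n → Subset n → Node n → Subset n
  tracked Δ d Γ = if isEmpty d then defer Γ else track d Δ Γ

  C : NodeSet n → FSet n
  C G (Γ , d) = G Γ ∧ subsetB d Γ

  f : FSet n → FSet n → FSet n
  f B Y (Δ , d) = B (Δ , d) ∧ all (λ Σ → any (λ Γ → Y (Γ , tracked Δ d Γ)) Σ) (concl Δ)

  g : FSet n → FSet n → FSet n
  g B Y (Δ , d) = B (Δ , d) ∧ any (λ Σ → all (λ Γ → Y (Γ , tracked Δ d Γ)) Σ) (concl Δ)

  Fe : FSet n → FSet n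
  Fe B (Δ , d) = B (Δ , d) ∧ isEmpty d

  Fn : FSet n → FSet n
  Fn B (Δ , d) = B (Δ , d) ∧ not (isEmpty d)

  fhat : FSet n → FSet n → FSet n → FSet n
  fhat B X Y x = (f B Y x ∧ Fn B x) ∨ (f B X x ∧ Fe B x)

  ghat : FSet n → FSet n → FSet n → FSet n
  ghat B X Y x = (g B Y x ∨ Fe B x) ∧ (g B X x ∨ Fn B x)

  -- Fixpoints over the finite base set computed by Kleene iteration;
  -- there are at most 4^n focused nodes, so 4^n + 1 steps suffice.
  iter : ℕ → (FSet n → FSet n) → FSet n → FSet n
  iter zero    h S = S
  iter (suc k) h S = h (iter k h S)

  steps : ℕ
  steps = suc (4 ^ n)

  emptyF : FSet n
  emptyF _ = false

  lfp : (FSet n → FSet n) → FSet n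
  lfp h = iter steps h emptyF

  gfp : FSet n → (FSet n → FSet n) → FSet n
  gfp B h = iter steps h B

  E : NodeSet n → FSet n
  E G = gfp (C G) (λ X → lfp (λ Y → fhat (C G) X Y))

  A : NodeSet n → FSet n
  A G = lfp (λ X → gfp (C G) (λ Y → ghat (C G) X Y))

{-# OPTIONS --safe #-}
-- Every operator entering E and A is monotone jointly in the base set and in
-- its set arguments: F and F̄ are intersections with the base set, so no
-- complement occurs. Both fixpoints are finite Kleene iterates, and iterating
-- a pointwise larger monotone operator from a larger start gives a larger
-- set. As C_G grows with G, so do E_G and A_G.
module Submission where

open import Defs
open import Data.Nat using (ℕ; zero; suc)
open import Data.Product using (_×_; _,_)
open import Data.Bool using (Bool; true; false; _∧_; _∨_)
open import Data.Bool.Properties using (∨-zeroʳ)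
open import Data.List using ([]; _∷_)
open import Data.Bool.ListAction using (any; all)
open import Function using (id)
open import Relation.Binary.PropositionalEquality using (_≡_; refl; trans; cong; cong₂)

infix 4 _⇒ᵇ_

_⇒ᵇ_ : Bool → Bool → Set
a ⇒ᵇ b = a ≡ true → b ≡ true

∧-mono : ∀ {a a' b b'} → a ⇒ᵇ a' → b ⇒ᵇ b' → a ∧ b ⇒ᵇ a' ∧ b'
∧-mono {true} {b = true} p q _ = cong₂ _∧_ (p refl) (q refl)

∨-mono : ∀ {a a' b b'} → a ⇒ᵇ a' → b ⇒ᵇ b' → a ∨ b ⇒ᵇ a' ∨ b'
∨-mono {true}       p q _  = cong (_∨ _) (p refl)
∨-mono {false} {a'} p q ab = trans (cong (a' ∨_) (q ab)) (∨-zeroʳ a')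

module _ {A : Set} {p q : A → Bool} (p⇒q : ∀ x → p x ⇒ᵇ q x) where

  any-mono : ∀ xs → any p xs ⇒ᵇ any q xs
  any-mono []       = id
  any-mono (x ∷ xs) = ∨-mono (p⇒q x) (any-mono xs)

  all-mono : ∀ xs → all p xs ⇒ᵇ all q xs
  all-mono []       = id
  all-mono (x ∷ xs) = ∧-mono (p⇒q x) (all-mono xs)

module _ {n : ℕ} (T : Tableau n) where
  open Tableau T

  infix 4 _⊑_

  _⊑_ : (FSet n → FSet n) → (FSet n → FSet n) → Set
  h ⊑ h' = ∀ {S S'} → S ⊆F S' → h S ⊆F h' S'

  iter-mono : ∀ k {h h' S S'} → h ⊑ h' → S ⊆F S' → iter T k h S ⊆F iter T k h' S'
  iter-mono zero    h⊑h' S⊆S' = S⊆S'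
  iter-mono (suc k) h⊑h' S⊆S' = h⊑h' (iter-mono k h⊑h' S⊆S')

  lfp-mono : ∀ {h h'} → h ⊑ h' → lfp T h ⊆F lfp T h'
  lfp-mono h⊑h' = iter-mono (steps T) h⊑h' (λ _ → id)

  gfp-mono : ∀ {B B' h h'} → B ⊆F B' → h ⊑ h' → gfp T B h ⊆F gfp T B' h'
  gfp-mono B⊆B' h⊑h' = iter-mono (steps T) h⊑h' B⊆B'

  C-mono : ∀ {G' G} → G' ⊆N G → C T G' ⊆F C T G
  C-mono G'⊆G (Γ , d) = ∧-mono (G'⊆G Γ) id

  module _ {B B' : FSet n} (B⊆B' : B ⊆F B') where

    Fe-mono : Fe T B ⊆F Fe T B'
    Fe-mono x = ∧-mono (B⊆B' x) id

    Fn-mono : Fn T B ⊆F Fn T B'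
    Fn-mono x = ∧-mono (B⊆B' x) id

    f-mono : ∀ {Y Y'} → Y ⊆F Y' → f T B Y ⊆F f T B' Y'
    f-mono Y⊆Y' (Δ , d) =
      ∧-mono (B⊆B' _) (all-mono (any-mono (λ Γ → Y⊆Y' _)) (concl Δ))

    g-mono : ∀ {Y Y'} → Y ⊆F Y' → g T B Y ⊆F g T B' Y'
    g-mono Y⊆Y' (Δ , d) =
      ∧-mono (B⊆B' _) (any-mono (all-mono (λ Γ → Y⊆Y' _)) (concl Δ))

    fhat-mono : ∀ {X X'} → X ⊆F X' → fhat T B X ⊑ fhat T B' X'
    fhat-mono X⊆X' Y⊆Y' x =
      ∨-mono (∧-mono (f-mono Y⊆Y' x) (Fn-mono x))
             (∧-mono (f-mono X⊆X' x) (Fe-mono x))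

    ghat-mono : ∀ {X X'} → X ⊆F X' → ghat T B X ⊑ ghat T B' X'
    ghat-mono X⊆X' Y⊆Y' x =
      ∧-mono (∨-mono (g-mono Y⊆Y' x) (Fe-mono x))
             (∨-mono (g-mono X⊆X' x) (Fn-mono x))

  E-mono : ∀ {G' G} → G' ⊆N G → E T G' ⊆F E T G
  E-mono {G'} {G} G'⊆G = gfp-mono C⊆C (λ X⊆X' → lfp-mono (fhat-mono C⊆C X⊆X'))
    where
    C⊆C : C T G' ⊆F C T G
    C⊆C = C-mono G'⊆G

  A-mono : ∀ {G' G} → G' ⊆N G → A T G' ⊆F A T G
  A-mono {G'} {G} G'⊆G = lfp-mono (λ X⊆X' → gfp-mono C⊆C (ghat-mono C⊆C X⊆X'))
    where
    C⊆C : C T G' ⊆F C T G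
    C⊆C = C-mono G'⊆G

lemma13 : ∀ {n : ℕ} (T : Tableau n) (G' G : NodeSet n) → G' ⊆N G →
              (E T G' ⊆F E T G) × (A T G' ⊆F A T G)
lemma13 T G' G G'⊆G = E-mono T G'⊆G , A-mono T G'⊆G
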